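{- For every integer $k \geq 2$ there exists a connected graph $G_k$ with exactly $15k$ vertices such that $z(G_k) \geq k$, i.e. for every placement of at most $k-1$ zombies on $G_k$ the survivor has a strategy to avoid capture forever.
   Context: All graphs are finite, simple and undirected. The (deterministic) zombies-and-survivor game on a connected graph $G$: in round $0$ the zombies choose starting vertices (several zombies may share a vertex), then the survivor chooses a starting vertex. In each subsequent round, first every zombie must move from its current vertex $u$ to a neighbour $w$ of $u$ that lies on a shortest path in $G$ from $u$ to the survivor's current vertex (if several such $w$ exist, the zombies choose); then the survivor either stays put or moves to an adjacent vertex. Both sides have full information. The zombies win if at some moment a zombie occupies the survivor's vertex; the survivor wins if this never happens. The zombie number $z(G)$ is the minimum number of zombies for which the zombies (choosing their starting positions) have a winning strategy. -}

module Defs where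

open import Data.Nat using (ℕ; zero; suc; _≤_; _<_)
open import Data.Fin using (Fin; toℕ)
open import Data.Bool using (Bool; true; false)
open import Data.Product using (Σ; ∃; _×_)
open import Data.Sum using (_⊎_)
open import Relation.Binary.PropositionalEquality using (_≡_; _≢_)

record Graph (n : ℕ) : Set where
  field
    adj     : Fin n → Fin n → Bool
    symm    : ∀ u v → adj u v ≡ adj v u
    irrefl  : ∀ u → adj u u ≡ false

open Graph public

Edge : ∀ {n} → Graph n → Fin n → Fin n → Set
Edge G u v = adj G u v ≡ true

data Walk {n : ℕ} (G : Graph n) : Fin n → Fin n → ℕ → Set where
  here : ∀ {u} → Walk G u u 0
  step : ∀ {u w v l} → Edge G u w → Walk G w v l → Walk G u v (suc l)

Connected : ∀ {n} → Graph n → Set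
Connected G = ∀ u v → ∃ λ l → Walk G u v l

IsDist : ∀ {n} → Graph n → Fin n → Fin n → ℕ → Set
IsDist G u v d = Walk G u v d × (∀ l → Walk G u v l → d ≤ l)

ZombieStep : ∀ {n} → Graph n → (u w v : Fin n) → Set
ZombieStep G u w v = Edge G u w × ∃ λ d → IsDist G u v (suc d) × IsDist G w v d

ZPos : ℕ → ℕ → Set
ZPos n m = Fin m → Fin n

-- A survivor strategy: at time t, having seen the zombie positions at
-- times 0..t (the positions after the zombies' moves in rounds 0..t),
-- choose the survivor's vertex at time t.  (Her own earlier choices are
-- determined by the strategy, so need not be part of the input.)
SurvivorStrategy : ℕ → ℕ → Set
SurvivorStrategy n m = (t : ℕ) → (Fin (suc t) → ZPos n m) → Fin n

svPos : ∀ {n m} → SurvivorStrategy n m → (ℕ → ZPos n m) → ℕ → Fin n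
svPos σ Z t = σ t (λ j → Z (toℕ j))

LegalUpTo : ∀ {n m} → Graph n → SurvivorStrategy n m → (ℕ → ZPos n m) → ℕ → Set
LegalUpTo G σ Z t = ∀ u → u < t → ∀ i → ZombieStep G (Z u i) (Z (suc u) i) (svPos σ Z u)

Evades : ∀ {n m} → Graph n → ZPos n m → SurvivorStrategy n m → Set
Evades {n} {m} G p σ =
  (Z : ℕ → ZPos n m) → Z 0 ≡ p → (t : ℕ) →
    -- not caught after the survivor's move in round t
    (LegalUpTo G σ Z t → ∀ i → Z t i ≢ svPos σ Z t)
    -- in round t+1: not caught after the zombies' move, and the survivor
    -- stays put or moves to an adjacent vertex
  × (LegalUpTo G σ Z (suc t) →
       (∀ i → Z (suc t) i ≢ svPos σ Z t)
     × (svPos σ Z (suc t) ≡ svPos σ Z t ⊎ Edge G (svPos σ Z t) (svPos σ Z (suc t))))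

SurvivorWins : ∀ {n} → Graph n → (m : ℕ) → ZPos n m → Set
SurvivorWins {n} G m p = Σ (SurvivorStrategy n m) λ σ → Evades G p σ

ZombieNumberAtLeast : ∀ {n} → Graph n → ℕ → Set
ZombieNumberAtLeast {n} G k = ∀ m → m < k → (p : ZPos n m) → SurvivorWins G m p

{-# OPTIONS --safe #-}
-- G_k is a cycle (the rim) of length 7k, a pendant vertex on every rim vertex, a hub
-- joined to all pendants, and k − 1 leaves on the hub. Fewer than k zombies leave some
-- block of 7 consecutive rim vertices (with their pendants) free; the survivor starts
-- there and runs around the rim forever. Every vertex reaches her within 4 steps through
-- the hub, so a zombie at least 5 ahead of her on the rim must leave it through its
-- pendant, and can only come back down at least 5 ahead of her again; zombies at least 2
-- behind her can only follow. Lower bounds on distances come from a potential that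
-- changes by at most one along every edge.
module Submission where

open import Defs
open import Data.Nat using (ℕ; _≤_; _*_)
open import Data.Product using (Σ; _×_)

open import Data.Fin using (Fin; zero; suc; toℕ; fromℕ<; combine; remQuot)
open import Data.Fin.Patterns using (0F; 1F; 6F)
open import Data.Fin.Properties
  using (toℕ<n; toℕ-fromℕ<; toℕ-combine; combine-remQuot; combine-monoˡ-<; +↔⊎;
         pigeonhole; ¬∀⟶∃¬; any?)
  renaming (_≟_ to _≟ᶠ_; <⇒≢ to <⇒≢ᶠ; <-cmp to <-cmpᶠ)
open import Data.Nat using (zero; suc; _+_; _∸_; _⊓_; _<_; _<?_; z≤n; s≤s; s≤s⁻¹)
open import Data.Nat.DivMod using (_%_; m%n<n; m<n⇒m%n≡m; n%n≡0; [m+n]%n≡m%n; m%n%n≡m%n; %-distribˡ-+)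
open import Data.Nat.GeneralisedArithmetic using (fold)
open import Data.Nat.Properties
open import Data.Nat.Tactic.RingSolver using (solve-∀)
open import Data.Product using (∃; _,_; proj₁; proj₂)
open import Data.Sum using (_⊎_; inj₁; inj₂; swap)
open import Data.Sum.Function.Propositional using (_⊎-↔_)
open import Data.Sum.Properties using (inj₁-injective)
open import Data.Unit using (⊤; tt)
open import Function using (_∘_; _↔_; Inverse; mk⇔)
open import Function.Properties.Inverse using (↔-refl; ↔-trans)
open import Relation.Binary using (Decidable; Symmetric; tri<; tri≈; tri>)
open import Relation.Binary.PropositionalEquality
open import Relation.Nullary using (¬_; yes; no; does; contradiction)
open import Relation.Nullary.Decidable using (_⊎-dec_; dec-true; dec-false; does-⇔)

outsideImage : ∀ {m n} → m < n → (f : Fin m → Fin n) → ∃ λ b → ∀ i → f i ≢ b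
outsideImage {m} {n} m<n f =
  let b , missed = ¬∀⟶∃¬ n _ (λ b → any? (λ i → f i ≟ᶠ b)) not-onto
  in b , λ i fi≡b → missed (i , fi≡b)
  where
  not-onto : ¬ (∀ b → ∃ λ i → f i ≡ b)
  not-onto section =
    let b , b′ , b<b′ , same = pigeonhole m<n (proj₁ ∘ section)
    in <⇒≢ᶠ b<b′ (trans (sym (proj₂ (section b))) (trans (cong f same) (proj₂ (section b′))))

module _ {n : ℕ} {G : Graph n} where

  Edge-sym : ∀ {u w} → Edge G u w → Edge G w u
  Edge-sym {u} {w} e = trans (symm G w u) e

  _++ʷ_ : ∀ {u v w l l′} → Walk G u v l → Walk G v w l′ → Walk G u w (l + l′)
  here     ++ʷ q = q
  step e p ++ʷ q = step e (p ++ʷ q)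

  reverseʷ : ∀ {u v l} → Walk G u v l → Walk G v u l
  reverseʷ here = here
  reverseʷ {l = suc l} (step e p) = subst (Walk G _ _) (+-comm l 1) (reverseʷ p ++ʷ step (Edge-sym e) here)

  connected-through : ∀ c → (∀ u → ∃ λ l → Walk G u c l) → Connected G
  connected-through c reach u v = _ , proj₂ (reach u) ++ʷ reverseʷ (proj₂ (reach v))

  Lipschitz : (Fin n → ℕ) → Set
  Lipschitz φ = ∀ {u w} → Edge G u w → φ u ≤ suc (φ w)

  potential≤length : ∀ {φ u v l} → Lipschitz φ → φ v ≡ 0 → Walk G u v l → φ u ≤ l
  potential≤length lip φv≡0 here       = ≤-reflexive φv≡0
  potential≤length lip φv≡0 (step e p) = ≤-trans (lip e) (s≤s (potential≤length lip φv≡0 p))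

  zombieStep-potential< : ∀ {φ u w v l} → Lipschitz φ → φ v ≡ 0 →
                          ZombieStep G u w v → Walk G u v l → φ w < l
  zombieStep-potential< lip φv≡0 (_ , _ , (_ , shortest) , (p , _)) q =
    ≤-trans (s≤s (potential≤length lip φv≡0 p)) (shortest _ q)

module GraphOn {V : Set} {n : ℕ} (V↔ : Fin n ↔ V)
               {R : V → V → Set} (R? : Decidable R) (R-sym : Symmetric R)
               (R-irrefl : ∀ a → ¬ R a a) where

  open Inverse V↔ public using (to; from; strictlyInverseˡ; strictlyInverseʳ)

  graph : Graph n
  graph = record
    { adj    = λ u w → does (R? (to u) (to w))
    ; symm   = λ u w → does-⇔ (mk⇔ R-sym R-sym) (R? (to u) (to w)) (R? (to w) (to u))
    ; irrefl = λ u → dec-false (R? (to u) (to u)) (R-irrefl (to u))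
    }

  Edge⇒R : ∀ {u w} → Edge graph u w → R (to u) (to w)
  Edge⇒R {u} {w} e with R? (to u) (to w) | e
  ... | yes r | _ = r

  R⇒Edge : ∀ {a b} → R a b → Edge graph (from a) (from b)
  R⇒Edge {a} {b} r =
    dec-true (R? _ _) (subst₂ R (sym (strictlyInverseˡ a)) (sym (strictlyInverseˡ b)) r)

  walk-from∘to : ∀ {u v l} → Walk graph (from (to u)) v l → Walk graph u v l
  walk-from∘to {u} = subst (λ x → Walk graph x _ _) (strictlyInverseʳ u)

module Cyclic (ℓ : ℕ) where

  L : ℕ
  L = suc ℓ

  next : Fin L → Fin L
  next j = fromℕ< (m%n<n (suc (toℕ j)) L)

  offset : Fin L → Fin L → ℕ
  offset j s = (toℕ j + (L ∸ toℕ s)) % L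

  back : ℕ → ℕ
  back o = (o + ℓ) % L

  cycleDist : ℕ → ℕ
  cycleDist o = o ⊓ (L ∸ o)

  toℕ-next : ∀ j → toℕ (next j) ≡ suc (toℕ j) % L
  toℕ-next j = toℕ-fromℕ< (m%n<n (suc (toℕ j)) L)

  suc%L : ∀ {o} → o < L → suc o % L ≡ suc o ⊎ suc o ≡ L
  suc%L {o} o<L with m≤n⇒m<n∨m≡n o<L
  ... | inj₁ 1+o<L = inj₁ (m<n⇒m%n≡m 1+o<L)
  ... | inj₂ 1+o≡L = inj₂ 1+o≡L

  wrap%L : ∀ {o} → suc o ≡ L → suc o % L ≡ 0
  wrap%L 1+o≡L = trans (cong (_% L) 1+o≡L) (n%n≡0 L)

  L∸o≡1+L∸1+o : ∀ {o} → o < L → L ∸ o ≡ suc (L ∸ suc o)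
  L∸o≡1+L∸1+o o<L = +-∸-assoc 1 (s≤s⁻¹ o<L)

  %-absorbˡ : ∀ a b → (a % L + b) % L ≡ (a + b) % L
  %-absorbˡ a b = begin
    (a % L + b) % L         ≡⟨ %-distribˡ-+ (a % L) b L ⟩
    (a % L % L + b % L) % L ≡⟨ cong (λ x → (x + b % L) % L) (m%n%n≡m%n a L) ⟩
    (a % L + b % L) % L     ≡⟨ %-distribˡ-+ a b L ⟨
    (a + b) % L             ∎
    where open ≡-Reasoning

  %-absorbʳ : ∀ a b → (a + b % L) % L ≡ (a + b) % L
  %-absorbʳ a b = begin
    (a + b % L) % L ≡⟨ cong (_% L) (+-comm a (b % L)) ⟩
    (b % L + a) % L ≡⟨ %-absorbˡ b a ⟩
    (b + a) % L     ≡⟨ cong (_% L) (+-comm b a) ⟩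
    (a + b) % L     ∎
    where open ≡-Reasoning

  offset<L : ∀ j s → offset j s < L
  offset<L j s = m%n<n (toℕ j + (L ∸ toℕ s)) L

  offset-self : ∀ s → offset s s ≡ 0
  offset-self s = trans (cong (_% L) (m+[n∸m]≡n (<⇒≤ (toℕ<n s)))) (n%n≡0 L)

  offset-nextˡ : ∀ j s → offset (next j) s ≡ suc (offset j s) % L
  offset-nextˡ j s = begin
    (toℕ (next j) + (L ∸ toℕ s)) % L     ≡⟨ cong (λ x → (x + (L ∸ toℕ s)) % L) (toℕ-next j) ⟩
    (suc (toℕ j) % L + (L ∸ toℕ s)) % L  ≡⟨ %-absorbˡ (suc (toℕ j)) (L ∸ toℕ s) ⟩
    suc (toℕ j + (L ∸ toℕ s)) % L        ≡⟨ %-absorbʳ 1 (toℕ j + (L ∸ toℕ s)) ⟨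
    suc (offset j s) % L                 ∎
    where open ≡-Reasoning

  offset-nextʳ : ∀ j s → offset j (next s) ≡ back (offset j s)
  offset-nextʳ j s = trans shifted (sym (%-absorbˡ (toℕ j + (L ∸ toℕ s)) ℓ))
    where
    open ≡-Reasoning
    ts≤ℓ : toℕ s ≤ ℓ
    ts≤ℓ = s≤s⁻¹ (toℕ<n s)
    j+L∸_ : ℕ → ℕ
    j+L∸ x = (toℕ j + (L ∸ x)) % L
    shifted : j+L∸ toℕ (next s) ≡ (toℕ j + (L ∸ toℕ s) + ℓ) % L
    shifted with suc%L (toℕ<n s)
    ... | inj₁ no-wrap = begin
      j+L∸ toℕ (next s)                   ≡⟨ cong j+L∸_ (trans (toℕ-next s) no-wrap) ⟩
      (toℕ j + (ℓ ∸ toℕ s)) % L           ≡⟨ [m+n]%n≡m%n (toℕ j + (ℓ ∸ toℕ s)) L ⟨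
      (toℕ j + (ℓ ∸ toℕ s) + L) % L       ≡⟨ cong (_% L) (+-suc (toℕ j + (ℓ ∸ toℕ s)) ℓ) ⟩
      (suc (toℕ j + (ℓ ∸ toℕ s)) + ℓ) % L ≡⟨ cong (λ x → (x + ℓ) % L) (+-suc (toℕ j) (ℓ ∸ toℕ s)) ⟨
      (toℕ j + suc (ℓ ∸ toℕ s) + ℓ) % L   ≡⟨ cong (λ x → (toℕ j + x + ℓ) % L) (L∸o≡1+L∸1+o (toℕ<n s)) ⟨
      (toℕ j + (L ∸ toℕ s) + ℓ) % L       ∎
    ... | inj₂ wrap = begin
      j+L∸ toℕ (next s)                   ≡⟨ cong j+L∸_ (trans (toℕ-next s) (wrap%L wrap)) ⟩
      (toℕ j + L) % L                     ≡⟨ cong (_% L) (+-assoc (toℕ j) 1 ℓ) ⟨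
      (toℕ j + 1 + ℓ) % L                 ≡⟨ cong (λ x → (toℕ j + x + ℓ) % L) L∸s≡1 ⟨
      (toℕ j + (L ∸ toℕ s) + ℓ) % L       ∎
      where
      L∸s≡1 : L ∸ toℕ s ≡ 1
      L∸s≡1 = trans (cong (_∸ toℕ s) (sym wrap)) (m+n∸n≡m 1 (toℕ s))

  back-suc : ∀ {o} → o < L → back (suc o) ≡ o
  back-suc {o} o<L = trans (cong (_% L) (sym (+-suc o ℓ))) (trans ([m+n]%n≡m%n o L) (m<n⇒m%n≡m o<L))

  back-zero : back 0 ≡ ℓ
  back-zero = m<n⇒m%n≡m (n<1+n ℓ)

  back-suc% : ∀ {o} → o < L → back (suc o % L) ≡ o
  back-suc% {o} o<L with suc%L o<L
  ... | inj₁ no-wrap = trans (cong back no-wrap) (back-suc o<L)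
  ... | inj₂ wrap    = trans (cong back (wrap%L wrap)) (trans back-zero (suc-injective (sym wrap)))

  back-≥ : ∀ {c o} → suc c ≤ o → o < L → c ≤ back o
  back-≥ {o = suc x} (s≤s c≤x) 1+x<L = subst (_ ≤_) (sym (back-suc (≤-trans (n≤1+n _) 1+x<L))) c≤x

  offset-next-next : ∀ j s → offset (next j) (next s) ≡ offset j s
  offset-next-next j s = begin
    offset (next j) (next s)     ≡⟨ offset-nextʳ (next j) s ⟩
    back (offset (next j) s)     ≡⟨ cong back (offset-nextˡ j s) ⟩
    back (suc (offset j s) % L)  ≡⟨ back-suc% (offset<L j s) ⟩
    offset j s                   ∎
    where open ≡-Reasoning

  offset-next-of-zero : ∀ j s → offset j s ≡ 0 → offset j (next s) ≡ ℓ
  offset-next-of-zero j s o≡0 = trans (offset-nextʳ j s) (trans (cong back o≡0) back-zero)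

  offset-ahead : ∀ {j s} → toℕ s ≤ toℕ j → offset j s ≡ toℕ j ∸ toℕ s
  offset-ahead {j} {s} s≤j = begin
    (toℕ j + (L ∸ toℕ s)) % L  ≡⟨ cong (_% L) (+-∸-assoc (toℕ j) (<⇒≤ (toℕ<n s))) ⟨
    (toℕ j + L ∸ toℕ s) % L    ≡⟨ cong (_% L) (+-∸-comm L s≤j) ⟩
    (toℕ j ∸ toℕ s + L) % L    ≡⟨ [m+n]%n≡m%n (toℕ j ∸ toℕ s) L ⟩
    (toℕ j ∸ toℕ s) % L        ≡⟨ m<n⇒m%n≡m (≤-<-trans (m∸n≤m (toℕ j) (toℕ s)) (toℕ<n j)) ⟩
    toℕ j ∸ toℕ s              ∎
    where open ≡-Reasoning

  offset-behind : ∀ {j s} → toℕ j < toℕ s → offset j s ≡ toℕ j + (L ∸ toℕ s)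
  offset-behind {j} {s} j<s =
    m<n⇒m%n≡m (≤-trans (+-monoˡ-< (L ∸ toℕ s) j<s)
                       (≤-reflexive (m+[n∸m]≡n (<⇒≤ (toℕ<n s)))))

  next-≢ : 0 < ℓ → ∀ j → next j ≢ j
  next-≢ 0<ℓ j next≡j with suc%L (toℕ<n j)
  ... | inj₁ no-wrap = 1+n≢n (trans (sym no-wrap) (trans (sym (toℕ-next j)) (cong toℕ next≡j)))
  ... | inj₂ wrap    = <⇒≢ 0<ℓ (sym (suc-injective (trans (sym wrap) (cong suc j≡0))))
    where
    j≡0 : toℕ j ≡ 0
    j≡0 = trans (cong toℕ (sym next≡j)) (trans (toℕ-next j) (wrap%L wrap))

  cycleDist-sucˡ : ∀ {o} → o < L → cycleDist o ≤ suc (cycleDist (suc o % L))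
  cycleDist-sucˡ {o} o<L with suc%L o<L
  ... | inj₁ no-wrap rewrite no-wrap =
    ⊓-mono-≤ (m≤n⇒m≤1+n (n≤1+n o)) (≤-reflexive (L∸o≡1+L∸1+o o<L))
  ... | inj₂ wrap    rewrite wrap%L wrap =
    ≤-trans (m⊓n≤n o (L ∸ o)) (≤-reflexive (trans (cong (_∸ o) (sym wrap)) (m+n∸n≡m 1 o)))

  cycleDist-sucʳ : ∀ {o} → o < L → cycleDist (suc o % L) ≤ suc (cycleDist o)
  cycleDist-sucʳ {o} o<L with suc%L o<L
  ... | inj₁ no-wrap rewrite no-wrap =
    ⊓-mono-≤ ≤-refl (≤-trans (∸-monoʳ-≤ L (n≤1+n o)) (n≤1+n (L ∸ o)))
  ... | inj₂ wrap    rewrite wrap%L wrap = z≤n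

-- The rim has length L = 10 + ℓ; the r leaves on the hub only pad the vertex count.
module Sunflower (ℓ r : ℕ) where

  open Cyclic (9 + ℓ) public

  Vertex : Set
  Vertex = Fin L ⊎ (Fin L ⊎ Fin (suc r))

  pattern cyc j     = inj₁ j
  pattern pendant j = inj₂ (inj₁ j)
  pattern hub       = inj₂ (inj₂ zero)
  pattern leaf y    = inj₂ (inj₂ (suc y))

  data Link : Vertex → Vertex → Set where
    arc   : ∀ j → Link (cyc j) (cyc (next j))
    spoke : ∀ j → Link (cyc j) (pendant j)
    petal : ∀ j → Link (pendant j) hub
    stem  : ∀ y → Link (leaf y) hub

  Adj : Vertex → Vertex → Set
  Adj a b = Link a b ⊎ Link b a

  link? : Decidable Link
  link? (cyc j) (cyc q) with q ≟ᶠ next j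
  ... | yes refl = yes (arc j)
  ... | no  q≢   = no λ { (arc _) → q≢ refl }
  link? (cyc j) (pendant q) with j ≟ᶠ q
  ... | yes refl = yes (spoke j)
  ... | no  j≢   = no λ { (spoke _) → j≢ refl }
  link? (cyc _)     hub         = no λ ()
  link? (cyc _)     (leaf _)    = no λ ()
  link? (pendant _) (cyc _)     = no λ ()
  link? (pendant _) (pendant _) = no λ ()
  link? (pendant j) hub         = yes (petal j)
  link? (pendant _) (leaf _)    = no λ ()
  link? hub         _           = no λ ()
  link? (leaf _)    (cyc _)     = no λ ()
  link? (leaf _)    (pendant _) = no λ ()
  link? (leaf y)    hub         = yes (stem y)
  link? (leaf _)    (leaf _)    = no λ ()

  Link⇒≢ : ∀ {a b} → Link a b → a ≢ b
  Link⇒≢ (arc j)   eq = next-≢ (s≤s z≤n) j (sym (inj₁-injective eq))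
  Link⇒≢ (spoke _) ()
  Link⇒≢ (petal _) ()
  Link⇒≢ (stem _)  ()

  Adj-irrefl : ∀ a → ¬ Adj a a
  Adj-irrefl a (inj₁ l) = Link⇒≢ l refl
  Adj-irrefl a (inj₂ l) = Link⇒≢ l refl

  Adj? : Decidable Adj
  Adj? a b = link? a b ⊎-dec link? b a

  module Play {n : ℕ} (V↔ : Fin n ↔ Vertex) where

    open GraphOn V↔ Adj? swap Adj-irrefl public

    -- The distance along the rim, capped by the detour of length 4 through the hub.
    near : ℕ → ℕ
    near o = cycleDist o ⊓ 4

    -- A lower bound on the distance to the survivor at cyc s.
    potential : Fin L → Vertex → ℕ
    potential s (cyc j)     = near (offset j s)
    potential s (pendant j) = suc (near (offset j s)) ⊓ 3
    potential s hub         = 2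
    potential s (leaf _)    = 2

    potential-Link : ∀ s {a b} → Link a b →
                     potential s a ≤ suc (potential s b) × potential s b ≤ suc (potential s a)
    potential-Link s (arc j) rewrite offset-nextˡ j s =
        ⊓-mono-≤ (cycleDist-sucˡ (offset<L j s)) (n≤1+n 4)
      , ⊓-mono-≤ (cycleDist-sucʳ (offset<L j s)) (n≤1+n 4)
    potential-Link s (spoke j) = ⊓-glb (m≤n⇒m≤1+n (n≤1+n _)) (m⊓n≤n _ 4) , m⊓n≤m _ 3
    potential-Link s (petal j) = m⊓n≤n _ 3 , s≤s (s≤s z≤n)
    potential-Link s (stem y)  = n≤1+n 2 , n≤1+n 2

    potential-Lipschitz : ∀ s → Lipschitz {G = graph} (potential s ∘ to)
    potential-Lipschitz s e with Edge⇒R e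
    ... | inj₁ l = proj₁ (potential-Link s l)
    ... | inj₂ l = proj₂ (potential-Link s l)

    potential-survivor : ∀ s → potential s (to (from (cyc s))) ≡ 0
    potential-survivor s rewrite strictlyInverseˡ (cyc s) | offset-self s = refl

    toHub : Vertex → ℕ
    toHub (cyc _)     = 2
    toHub (pendant _) = 1
    toHub hub         = 0
    toHub (leaf _)    = 1

    walk-to-hub : ∀ a → Walk graph (from a) (from hub) (toHub a)
    walk-to-hub (cyc j)     = step (R⇒Edge (inj₁ (spoke j))) (walk-to-hub (pendant j))
    walk-to-hub (pendant j) = step (R⇒Edge (inj₁ (petal j))) here
    walk-to-hub hub         = here
    walk-to-hub (leaf y)    = step (R⇒Edge (inj₁ (stem y))) here

    walk-from-hub : ∀ s → Walk graph (from hub) (from (cyc s)) 2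
    walk-from-hub s = step (R⇒Edge (inj₂ (petal s))) (step (R⇒Edge (inj₂ (spoke s))) here)

    connected : Connected graph
    connected = connected-through (from hub) λ u → _ , walk-from∘to (walk-to-hub (to u))

    potential-drops : ∀ {u w s} → ZombieStep graph u w (from (cyc s)) → potential s (to w) < toHub (to u) + 2
    potential-drops {u} {s = s} zombie-step =
      zombieStep-potential< {φ = potential s ∘ to} (potential-Lipschitz s) (potential-survivor s) zombie-step
        (walk-from∘to (walk-to-hub (to u) ++ʷ walk-from-hub s))

    near<⇒ : ∀ {o c} → near o < c → c ≤ 4 → o < c ⊎ L < o + c
    near<⇒ {o} {c} near<c c≤4 with o <? c | L ∸ o <? c
    ... | yes o<c | _ = inj₁ o<c
    ... | no  _   | yes L∸o<c = inj₂ (≤-<-trans (m≤n+m∸n L o) (+-monoʳ-< o L∸o<c))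
    ... | no  o≮c | no  L∸o≮c =
      contradiction (⊓-glb (⊓-glb (≮⇒≥ o≮c) (≮⇒≥ L∸o≮c)) c≤4) (<⇒≱ near<c)

    far-if-near< : ∀ {o c} → near o < c → c ≤ 4 → c ≤ o → 6 ≤ o
    far-if-near< {o} {c} near<c c≤4 c≤o with near<⇒ near<c c≤4
    ... | inj₁ o<c = contradiction c≤o (<⇒≱ o<c)
    ... | inj₂ L<o+c = ≮⇒≥ λ o<6 →
      <⇒≱ L<o+c (≤-trans (+-mono-≤ (s≤s⁻¹ o<6) c≤4) (≤-trans (n≤1+n 9) (m≤m+n 10 ℓ)))

    Clear : ℕ → Set
    Clear o = 5 ≤ o × 2 + o ≤ L

    Clear-back : ∀ {o} → 6 ≤ o → o < L → Clear (back o)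
    Clear-back {suc x} 6≤o o<L =
      back-≥ 6≤o o<L , subst (λ y → 2 + y ≤ L) (sym (back-suc (≤-trans (n≤1+n _) o<L))) o<L

    Good : Fin L → Vertex → Set
    Good s (cyc j)     = Clear (offset j s)
    Good s (pendant j) = 3 ≤ offset j s
    Good s hub         = ⊤
    Good s (leaf _)    = ⊤

    Clear-ahead : ∀ {j s} → toℕ s + 5 ≤ toℕ j → 0 < toℕ s → Clear (offset j s)
    Clear-ahead {j} {s} s+5≤j 0<s rewrite offset-ahead (≤-trans (m≤m+n (toℕ s) 5) s+5≤j) =
      m+n≤o⇒m≤o∸n 5 (subst (_≤ toℕ j) (+-comm (toℕ s) 5) s+5≤j) , 2+j∸s≤L
      where
      open ≤-Reasoning
      2+j∸s≤L : 2 + (toℕ j ∸ toℕ s) ≤ L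
      2+j∸s≤L = begin
        2 + (toℕ j ∸ toℕ s) ≤⟨ +-monoʳ-≤ 2 (∸-monoʳ-≤ (toℕ j) 0<s) ⟩
        2 + (toℕ j ∸ 1)     ≡⟨ cong suc (m+[n∸m]≡n (≤-trans 0<s (≤-trans (m≤m+n (toℕ s) 5) s+5≤j))) ⟩
        suc (toℕ j)         ≤⟨ toℕ<n j ⟩
        L                   ∎

    Clear-behind : ∀ {j s} → 2 + toℕ j ≤ toℕ s → toℕ s + 5 ≤ L → Clear (offset j s)
    Clear-behind {j} {s} 2+j≤s s+5≤L rewrite offset-behind {j} {s} (≤-trans (n≤1+n _) 2+j≤s) =
      ≤-trans (m+n≤o⇒m≤o∸n 5 (subst (_≤ L) (+-comm (toℕ s) 5) s+5≤L))
              (m≤n+m (L ∸ toℕ s) (toℕ j)) ,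
      (begin
        2 + (toℕ j + (L ∸ toℕ s)) ≡⟨ +-assoc 2 (toℕ j) (L ∸ toℕ s) ⟨
        2 + toℕ j + (L ∸ toℕ s)   ≤⟨ +-monoˡ-≤ (L ∸ toℕ s) 2+j≤s ⟩
        toℕ s + (L ∸ toℕ s)       ≡⟨ m+[n∸m]≡n (<⇒≤ (toℕ<n s)) ⟩
        L                         ∎)
      where open ≤-Reasoning

    1+m⊓3<2⇒m<1 : ∀ m → suc m ⊓ 3 < 2 → m < 1
    1+m⊓3<2⇒m<1 zero    _ = s≤s z≤n
    1+m⊓3<2⇒m<1 (suc _) (s≤s (s≤s ()))

    Good-step : ∀ s {a b} → Adj a b → potential s b < toHub a + 2 → Good s a → Good (next s) b
    Good-step s (inj₁ (arc j)) _ clear = subst Clear (sym (offset-next-next j s)) clear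
    Good-step s (inj₂ (arc q)) near<4 (5≤o′ , _) = subst Clear (sym (offset-nextʳ q s))
      (Clear-back (far-if-near< near<4 ≤-refl (s≤s⁻¹ 5≤1+o)) (offset<L q s))
      where
      5≤1+o : 5 ≤ suc (offset q s)
      5≤1+o with suc%L (offset<L q s) | subst (5 ≤_) (offset-nextˡ q s) 5≤o′
      ... | inj₁ no-wrap | 5≤o = subst (5 ≤_) no-wrap 5≤o
      ... | inj₂ wrap    | 5≤o = contradiction (subst (5 ≤_) (wrap%L wrap) 5≤o) λ ()
    Good-step s (inj₁ (spoke j)) _ (5≤o , _) =
      subst (3 ≤_) (sym (offset-nextʳ j s)) (back-≥ (≤-trans (n≤1+n 4) 5≤o) (offset<L j s))
    Good-step s (inj₂ (spoke j)) near<3 3≤o = subst Clear (sym (offset-nextʳ j s))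
      (Clear-back (far-if-near< near<3 (n≤1+n 3) 3≤o) (offset<L j s))
    Good-step s (inj₁ (petal _)) _ _ = tt
    Good-step s (inj₂ (petal q)) drop _ with near<⇒ (1+m⊓3<2⇒m<1 (near (offset q s)) drop) (s≤s z≤n)
    ... | inj₁ o<1 = subst (3 ≤_) (sym (offset-next-of-zero q s (n<1⇒n≡0 o<1))) (m≤m+n 3 (6 + ℓ))
    ... | inj₂ L<o+1 = contradiction (subst (_≤ L) (+-comm 1 (offset q s)) (offset<L q s)) (<⇒≱ L<o+1)
    Good-step s (inj₁ (stem _)) _ _ = tt
    Good-step s (inj₂ (stem _)) _ _ = tt

    Good⇒≢survivor : ∀ {s} a → Good s a → a ≢ cyc s
    Good⇒≢survivor (cyc j) (5≤o , _) refl = contradiction (subst (5 ≤_) (offset-self j) 5≤o) λ ()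

    Good-next⇒≢survivor : ∀ {s} a → Good (next s) a → a ≢ cyc s
    Good-next⇒≢survivor (cyc j) (_ , 2+o≤L) refl =
      1+n≰n (s≤s⁻¹ (subst (λ o → 2 + o ≤ L) (offset-next-of-zero j j (offset-self j)) 2+o≤L))

    to-from : ∀ {u a} → u ≡ from a → to u ≡ a
    to-from {a = a} refl = strictlyInverseˡ a

    module Run {m : ℕ} (p : ZPos n m) (s₀ : Fin L) (start-good : ∀ i → Good s₀ (to (p i))) where

      rim : ℕ → Fin L
      rim = fold s₀ next

      strategy : SurvivorStrategy n m
      strategy t _ = from (cyc (rim t))

      stays-good : ∀ Z → Z 0 ≡ p → ∀ t → LegalUpTo graph strategy Z t →
                   ∀ i → Good (rim t) (to (Z t i))
      stays-good Z Z₀≡p zero    _     i = subst (λ q → Good s₀ (to (q i))) (sym Z₀≡p) (start-good i)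
      stays-good Z Z₀≡p (suc t) legal i =
        Good-step (rim t) (Edge⇒R (proj₁ zombie-step)) (potential-drops zombie-step)
          (stays-good Z Z₀≡p t (λ u u<t → legal u (m≤n⇒m≤1+n u<t)) i)
        where
        zombie-step : ZombieStep graph (Z t i) (Z (suc t) i) (from (cyc (rim t)))
        zombie-step = legal t ≤-refl i

      evades : Evades graph p strategy
      evades Z Z₀≡p t =
          (λ legal i caught → Good⇒≢survivor _ (stays-good Z Z₀≡p t legal i) (to-from caught))
        , λ legal →
              (λ i caught → Good-next⇒≢survivor _ (stays-good Z Z₀≡p (suc t) legal i) (to-from caught))
            , inj₂ (R⇒Edge (inj₁ (arc (rim t))))

    survives : ∀ {m} (p : ZPos n m) s → (∀ i → Good s (to (p i))) → SurvivorWins graph m p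
    survives p s start-good = Run.strategy p s start-good , Run.evades p s start-good

module Placement (m′ : ℕ) where

  k : ℕ
  k = 2 + m′

  open Sunflower (4 + m′ * 7) (suc m′)

  vertex-count : L + (L + k) ≡ 15 * k
  vertex-count = lemma m′
    where
    lemma : ∀ m → 10 + (4 + m * 7) + (10 + (4 + m * 7) + (2 + m)) ≡ 15 * (2 + m)
    lemma = solve-∀

  Vertex↔ : Fin (15 * k) ↔ Vertex
  Vertex↔ = subst (λ N → Fin N ↔ Vertex) vertex-count (↔-trans +↔⊎ (↔-refl ⊎-↔ +↔⊎))

  open Play Vertex↔ public

  inBlock : Fin k → Fin 7 → Fin L
  inBlock = combine {k} {7}

  toℕ-inBlock : ∀ b r → toℕ (inBlock b r) ≡ 7 * toℕ b + toℕ r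
  toℕ-inBlock = toℕ-combine {k} {7}

  start : Fin k → Fin L
  start b = inBlock b 1F

  start≡1+ : ∀ b → toℕ (start b) ≡ suc (toℕ (inBlock b 0F))
  start≡1+ b = trans (toℕ-inBlock b 1F) (trans (+-suc (7 * toℕ b) 0) (cong suc (sym (toℕ-inBlock b 0F))))

  start+5≡ : ∀ b → toℕ (start b) + 5 ≡ toℕ (inBlock b 6F)
  start+5≡ b =
    trans (cong (_+ 5) (toℕ-inBlock b 1F)) (trans (+-assoc (7 * toℕ b) 1 5) (sym (toℕ-inBlock b 6F)))

  Clear-inBlock : ∀ {a b} (r : Fin 7) → a ≢ b → Clear (offset (inBlock a r) (start b))
  Clear-inBlock {a} {b} r a≢b with <-cmpᶠ a b
  ... | tri≈ _ a≡b _ = contradiction a≡b a≢b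
  ... | tri< a<b _ _ = Clear-behind
      (subst (2 + toℕ (inBlock a r) ≤_) (sym (start≡1+ b)) (s≤s (combine-monoˡ-< r 0F a<b)))
      (subst (_≤ L) (sym (start+5≡ b)) (<⇒≤ (toℕ<n (inBlock b 6F))))
  ... | tri> _ _ b<a = Clear-ahead
      (subst (_≤ toℕ (inBlock a r)) (sym (start+5≡ b)) (<⇒≤ (combine-monoˡ-< 6F r b<a)))
      (subst (0 <_) (sym (toℕ-inBlock b 1F)) (m≤n+m 1 (7 * toℕ b)))

  -- The hub and the leaves are good for every start, so their block is irrelevant.
  block : Vertex → Fin k
  block (cyc j)          = proj₁ (remQuot {k} 7 j)
  block (pendant j)      = proj₁ (remQuot {k} 7 j)
  block (inj₂ (inj₂ _))  = zero

  Clear-outside-block : ∀ j {b} → proj₁ (remQuot {k} 7 j) ≢ b → Clear (offset j (start b))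
  Clear-outside-block j {b} ≢b = subst (λ i → Clear (offset i (start b))) (combine-remQuot {k} 7 j)
                                   (Clear-inBlock (proj₂ (remQuot {k} 7 j)) ≢b)

  Good-start : ∀ a {b} → block a ≢ b → Good (start b) a
  Good-start (cyc j)     ≢b = Clear-outside-block j ≢b
  Good-start (pendant j) ≢b = ≤-trans (m≤m+n 3 2) (proj₁ (Clear-outside-block j ≢b))
  Good-start hub         _  = tt
  Good-start (leaf _)    _  = tt

  zombie-number≥k : ZombieNumberAtLeast graph k
  zombie-number≥k m m<k p =
    let b , unoccupied = outsideImage m<k (block ∘ to ∘ p)
    in survives p (start b) λ i → Good-start (to (p i)) (unoccupied i)

theorem3 : (k : ℕ) → 2 ≤ k → Σ (Graph (15 * k)) λ G → Connected G × ZombieNumberAtLeast G k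
theorem3 (suc (suc m′)) _ = graph , connected , zombie-number≥k
  where open Placement m′
theorem3 (suc zero) (s≤s ())
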